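{- Let $P$ be a finite poset, and let $A,B,C,D$ be pairwise distinct antichains of $P$. If $\operatorname{conv}(\chi_A,\chi_B,\chi_C,\chi_D)$ is a square face of $\mathcal{C}(P)$, then the poset $(\{A,B,C,D\},\subseteq)$ is isomorphic to one of the following: (a) the poset with a bottom element, a top element, and two incomparable elements in between (the Boolean lattice of rank $2$); (b) the disjoint union of two $2$-element chains; (c) the $4$-element antichain.
   Context: For a finite poset $P$, the chain polytope is $\mathcal{C}(P)=\{x\in\mathbb{R}^P: x_p\ge 0 \text{ for all } p,\ x_{p_1}+\dots+x_{p_k}\le 1 \text{ whenever } p_1<\dots<p_k \text{ in } P\}$. A square face is a $2$-dimensional face with exactly four vertices. $\chi_W$ is the characteristic vector of $W\subseteq P$.
   Formalization: The chain polytope $\mathcal{C}(P)$, the convex hull and the notions of face, dimension and vertex are taken over the rationals, in ℚ^P, rather than in $\mathbb{R}^P$. -}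

module Defs where

open import Level using (0ℓ)
open import Data.Nat using (ℕ; zero; suc)
open import Data.Fin using (Fin; zero; suc)
open import Data.Fin.Subset using (Subset; _∈_; _⊆_; inside; outside)
open import Data.Fin.Permutation using (Permutation′; _⟨$⟩ʳ_)
open import Data.Vec using (lookup)
open import Data.Rational using (ℚ; 0ℚ; 1ℚ; _+_; _*_; _-_; _≤_; _<_)
open import Data.List using (List; map; foldr)
open import Data.List.Relation.Unary.Linked using (Linked)
open import Data.Product using (Σ; _×_; ∃)
open import Data.Sum using (_⊎_)
open import Data.Empty using (⊥)
open import Data.Unit using (⊤)
open import Relation.Nullary using (¬_)
open import Relation.Binary.PropositionalEquality using (_≡_; _≢_)
open import Relation.Binary.Structures using (IsPartialOrder)

Vecℚ : ℕ → Set
Vecℚ n = Fin n → ℚ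

_≈v_ : ∀ {n} → Vecℚ n → Vecℚ n → Set
x ≈v y = ∀ i → x i ≡ y i

Σfin : ∀ {n} → (Fin n → ℚ) → ℚ
Σfin {zero}  f = 0ℚ
Σfin {suc n} f = f zero + Σfin (λ i → f (suc i))

_·_ : ∀ {n} → Vecℚ n → Vecℚ n → ℚ
c · x = Σfin (λ i → c i * x i)

record FinPoset (n : ℕ) : Set₁ where
  field
    _≼_        : Fin n → Fin n → Set
    isPartialOrder : IsPartialOrder _≡_ _≼_

module _ {n : ℕ} (P : FinPoset n) where
  open FinPoset P

  _≺_ : Fin n → Fin n → Set
  p ≺ q = p ≼ q × p ≢ q

  IsChain : List (Fin n) → Set
  IsChain = Linked _≺_

  ChainPolytope : Vecℚ n → Set
  ChainPolytope x = (∀ p → 0ℚ ≤ x p) × (∀ l → IsChain l → foldr _+_ 0ℚ (map x l) ≤ 1ℚ)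

  IsAntichain : Subset n → Set
  IsAntichain A = ∀ p q → p ∈ A → q ∈ A → p ≼ q → p ≡ q

χ : ∀ {n} → Subset n → Vecℚ n
χ W p with lookup W p
... | inside  = 1ℚ
... | outside = 0ℚ

Conv : ∀ {n k} → (Fin k → Vecℚ n) → Vecℚ n → Set
Conv {n} {k} v x = Σ (Fin k → ℚ) λ λ' →
  (∀ i → 0ℚ ≤ λ' i) × (Σfin λ' ≡ 1ℚ) × (x ≈v (λ p → Σfin (λ i → λ' i * v i p)))

IsFaceOf : ∀ {n} → (Vecℚ n → Set) → (Vecℚ n → Set) → Set
IsFaceOf {n} F Q = Σ (Vecℚ n) λ c → Σ ℚ λ d →
  (∀ x → Q x → (c · x) ≤ d) ×
  (∀ x → (Q x × (c · x) ≡ d → F x) × (F x → Q x × (c · x) ≡ d))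

AffinelyIndependent : ∀ {n k} → (Fin k → Vecℚ n) → Set
AffinelyIndependent {n} {k} v = ∀ (λ' : Fin k → ℚ) → Σfin λ' ≡ 0ℚ →
  (∀ p → Σfin (λ i → λ' i * v i p) ≡ 0ℚ) → ∀ i → λ' i ≡ 0ℚ

HasDimension2 : ∀ {n} → (Vecℚ n → Set) → Set
HasDimension2 {n} F =
  (Σ (Fin 3 → Vecℚ n) λ v → (∀ i → F (v i)) × AffinelyIndependent v) ×
  (∀ (v : Fin 4 → Vecℚ n) → (∀ i → F (v i)) → ¬ AffinelyIndependent v)

IsVertex : ∀ {n} → (Vecℚ n → Set) → Vecℚ n → Set
IsVertex F v = F v × (∀ y z t → F y → F z → 0ℚ < t → t < 1ℚ →
  v ≈v (λ p → t * y p + (1ℚ - t) * z p) → y ≈v z)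

HasExactlyFourVertices : ∀ {n} → (Vecℚ n → Set) → Set
HasExactlyFourVertices {n} F = Σ (Fin 4 → Vecℚ n) λ w →
  (∀ i → IsVertex F (w i)) × (∀ i j → w i ≈v w j → i ≡ j) ×
  (∀ v → IsVertex F v → ∃ λ i → v ≈v w i)

IsSquareFaceOf : ∀ {n} → (Vecℚ n → Set) → (Vecℚ n → Set) → Set
IsSquareFaceOf F Q = IsFaceOf F Q × HasDimension2 F × HasExactlyFourVertices F

quad : ∀ {ℓ} {X : Set ℓ} → X → X → X → X → Fin 4 → X
quad a b c d zero = a
quad a b c d (suc zero) = b
quad a b c d (suc (suc zero)) = c
quad a b c d (suc (suc (suc zero))) = d

Iso4 : (Fin 4 → Fin 4 → Set) → (Fin 4 → Fin 4 → Set) → Set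
Iso4 R S = Σ (Permutation′ 4) λ π →
  ∀ i j → (R i j → S (π ⟨$⟩ʳ i) (π ⟨$⟩ʳ j)) × (S (π ⟨$⟩ʳ i) (π ⟨$⟩ʳ j) → R i j)

BooleanRank2 : Fin 4 → Fin 4 → Set
BooleanRank2 i j = i ≡ j ⊎ i ≡ zero ⊎ j ≡ suc (suc (suc zero))

TwoChains : Fin 4 → Fin 4 → Set
TwoChains i j = i ≡ j ⊎ (i ≡ zero × j ≡ suc zero)
                     ⊎ (i ≡ suc (suc zero) × j ≡ suc (suc (suc zero)))

Antichain4 : Fin 4 → Fin 4 → Set
Antichain4 i j = i ≡ j

-- Three distinct 0/1-vectors are
-- affinely independent, so no point lies in exactly one or exactly three of the sets, since
-- the coefficient of the odd one out in an affine relation would vanish. If none of the three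
-- pairings of the sets formed a parallelogram χ W + χ Z = χ X + χ Y, each pairing would be
-- crossed by some point, forcing μ A + μ B = μ A + μ C = μ A + μ D = 0 for every affine
-- relation μ, hence μ = 0. So after relabelling A ∩ D = B ∩ C and A ∪ D = B ∪ C, every point
-- of A ∪ D outside A ∩ D lies on exactly one side of the square A – B – D – C, and inclusions
-- between the sets are determined by which sides are occupied; the nine occupancy patterns
-- compatible with distinctness give the three posets.

module Submission where

open import Defs
open import Data.Nat using (ℕ; zero; suc; _≤_; z≤n; s≤s)
open import Data.Nat.Properties using (m≤n⇒m≤1+n; ≤-refl)
open import Data.Bool using (Bool; true; false; not; _∧_; _∨_)
open import Data.Bool.Properties using (¬-not) renaming (_≟_ to _≟ᵇ_)
open import Data.Fin using (Fin; zero; suc; punchIn; punchOut; _≟_)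
open import Data.Fin.Patterns using (0F; 1F; 2F; 3F)
open import Data.Fin.Properties using (punchInᵢ≢i; punchIn-injective; punchIn-punchOut; all?; any?; ¬∀⟶∃¬)
open import Data.Fin.Subset using (Subset; _⊆_)
open import Data.Fin.Subset.Properties using (⊆-antisym)
open import Data.Fin.Permutation
  using (Permutation′; _⟨$⟩ʳ_; _⟨$⟩ˡ_; inverseʳ; inverseˡ; id; flip; transpose; _∘ₚ_)
open import Data.Vec using (Vec; []; _∷_; lookup; tabulate; replicate)
open import Data.Vec.Properties
  using (lookup∘tabulate; tabulate∘lookup; tabulate-cong; lookup-replicate; []=⇒lookup; lookup⇒[]=)
  renaming (≡-dec to ≡-decⱽ)
open import Data.Rational using (ℚ; 0ℚ; 1ℚ; ½; _+_; _*_; _-_)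
  renaming (_≤_ to _≤ᵠ_; _≤?_ to _≤ᵠ?_)
open import Data.Rational.Properties
  using (+-0-commutativeMonoid; +-identityˡ; +-identityʳ; *-identityˡ; *-identityʳ; *-zeroˡ; *-zeroʳ)
  renaming (≤-refl to ≤ᵠ-refl)
open import Data.Rational.Solver using (module +-*-Solver)
open +-*-Solver using (solve; _:=_; _:+_; _:*_; _:-_; con)
open import Algebra.Properties.CommutativeMonoid.Sum +-0-commutativeMonoid
  using (sum; sum-remove; sum-permute; sum-cong-≗; sum-replicate-zero)
open import Data.Product using (Σ; _×_; _,_; ∃; proj₁; proj₂)
open import Data.Sum using (_⊎_; inj₁; inj₂) renaming (map to map⊎)
open import Data.Empty using (⊥-elim)
open import Function using (_∘_; Injective; _⇔_; mk⇔; Equivalence)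
open import Relation.Nullary using (¬_; Dec; yes; no; does)
open import Relation.Nullary.Decidable
  using (True; toWitness; dec-true; dec-false; _×-dec_; _⊎-dec_; _→-dec_)
open import Relation.Binary.PropositionalEquality

open ≡-Reasoning

Σfin≡sum : ∀ {n} (f : Fin n → ℚ) → Σfin f ≡ sum f
Σfin≡sum {zero}  f = refl
Σfin≡sum {suc n} f = cong (f zero +_) (Σfin≡sum (f ∘ suc))

Σfin-cong : ∀ {n} {f g : Fin n → ℚ} → (∀ i → f i ≡ g i) → Σfin f ≡ Σfin g
Σfin-cong {f = f} {g} f≗g = begin
  Σfin f  ≡⟨ Σfin≡sum f ⟩
  sum f   ≡⟨ sum-cong-≗ f≗g ⟩
  sum g   ≡⟨ Σfin≡sum g ⟨
  Σfin g  ∎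

Σfin-zero : ∀ n → Σfin {n} (λ _ → 0ℚ) ≡ 0ℚ
Σfin-zero n = trans (Σfin≡sum {n} (λ _ → 0ℚ)) (sum-replicate-zero n)

Σfin-punchIn : ∀ {n} (f : Fin (suc n) → ℚ) i → Σfin f ≡ f i + Σfin (f ∘ punchIn i)
Σfin-punchIn f i = begin
  Σfin f                     ≡⟨ Σfin≡sum f ⟩
  sum f                      ≡⟨ sum-remove {i = i} f ⟩
  f i + sum (f ∘ punchIn i)  ≡⟨ cong (f i +_) (Σfin≡sum (f ∘ punchIn i)) ⟨
  f i + Σfin (f ∘ punchIn i) ∎

Σfin-permute : ∀ {n} (f : Fin n → ℚ) (σ : Permutation′ n) → Σfin (f ∘ (σ ⟨$⟩ʳ_)) ≡ Σfin f
Σfin-permute f σ = begin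
  Σfin (f ∘ (σ ⟨$⟩ʳ_))  ≡⟨ Σfin≡sum (f ∘ (σ ⟨$⟩ʳ_)) ⟩
  sum (f ∘ (σ ⟨$⟩ʳ_))   ≡⟨ sum-permute f σ ⟨
  sum f                 ≡⟨ Σfin≡sum f ⟨
  Σfin f                ∎

Σfin-drop : ∀ {n} (f : Fin (suc n) → ℚ) i → f i ≡ 0ℚ → Σfin f ≡ 0ℚ → Σfin (f ∘ punchIn i) ≡ 0ℚ
Σfin-drop f i fi≡0 Σf≡0 = begin
  Σfin (f ∘ punchIn i)        ≡⟨ +-identityˡ _ ⟨
  0ℚ + Σfin (f ∘ punchIn i)   ≡⟨ cong (_+ Σfin (f ∘ punchIn i)) fi≡0 ⟨
  f i + Σfin (f ∘ punchIn i)  ≡⟨ Σfin-punchIn f i ⟨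
  Σfin f                      ≡⟨ Σf≡0 ⟩
  0ℚ                          ∎

unitWeight : ∀ {k} → Fin k → Fin k → ℚ
unitWeight i j with i ≟ j
... | yes _ = 1ℚ
... | no  _ = 0ℚ

unitWeight-nonneg : ∀ {k} (i j : Fin k) → 0ℚ ≤ᵠ unitWeight i j
unitWeight-nonneg i j with i ≟ j
... | yes _ = toWitness {a? = 0ℚ ≤ᵠ? 1ℚ} _
... | no  _ = ≤ᵠ-refl

Σfin-unitWeight : ∀ {k} (i : Fin (suc k)) (f : Fin (suc k) → ℚ) → Σfin (λ j → unitWeight i j * f j) ≡ f i
Σfin-unitWeight {k} i f = begin
  Σfin (λ j → unitWeight i j * f j)
    ≡⟨ Σfin-punchIn (λ j → unitWeight i j * f j) i ⟩
  unitWeight i i * f i + Σfin (λ j → unitWeight i (punchIn i j) * f (punchIn i j))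
    ≡⟨ cong₂ _+_ diagonal (Σfin-cong off-diagonal) ⟩
  f i + Σfin {k} (λ _ → 0ℚ)
    ≡⟨ cong (f i +_) (Σfin-zero k) ⟩
  f i + 0ℚ
    ≡⟨ +-identityʳ (f i) ⟩
  f i ∎
  where
  diagonal : unitWeight i i * f i ≡ f i
  diagonal with i ≟ i
  ... | yes _  = *-identityˡ (f i)
  ... | no i≢i = ⊥-elim (i≢i refl)
  off-diagonal : ∀ j → unitWeight i (punchIn i j) * f (punchIn i j) ≡ 0ℚ
  off-diagonal j with i ≟ punchIn i j
  ... | yes i≡iʲ = ⊥-elim (punchInᵢ≢i i j (sym i≡iʲ))
  ... | no  _    = *-zeroˡ (f (punchIn i j))

Conv-vertex : ∀ {n k} (v : Fin (suc k) → Vecℚ n) i → Conv v (v i)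
Conv-vertex v i =
  unitWeight i , unitWeight-nonneg i ,
  trans (Σfin-cong (λ j → sym (*-identityʳ (unitWeight i j)))) (Σfin-unitWeight i (λ _ → 1ℚ)) ,
  λ p → sym (Σfin-unitWeight i (λ j → v j p))

IsAffineRelation : ∀ {n k} → (Fin k → Vecℚ n) → (Fin k → ℚ) → Set
IsAffineRelation v μ = Σfin μ ≡ 0ℚ × (∀ p → Σfin (λ i → μ i * v i p) ≡ 0ℚ)

independent-resp : ∀ {n k} {v w : Fin k → Vecℚ n} → (∀ i p → v i p ≡ w i p) →
                   AffinelyIndependent v → AffinelyIndependent w
independent-resp v≗w ind μ Σμ≡0 mass≡0 =
  ind μ Σμ≡0 (λ p → trans (Σfin-cong (λ i → cong (μ i *_) (v≗w i p))) (mass≡0 p))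

relation-permute : ∀ {n k} {v : Fin k → Vecℚ n} {μ} (σ : Permutation′ k) →
                   IsAffineRelation v μ → IsAffineRelation (v ∘ (σ ⟨$⟩ʳ_)) (μ ∘ (σ ⟨$⟩ʳ_))
relation-permute {v = v} {μ} σ (Σμ≡0 , mass≡0) =
  trans (Σfin-permute μ σ) Σμ≡0 ,
  λ p → trans (Σfin-permute (λ i → μ i * v i p) σ) (mass≡0 p)

independent-permute : ∀ {n k} {v : Fin k → Vecℚ n} (σ : Permutation′ k) →
                      AffinelyIndependent (v ∘ (σ ⟨$⟩ʳ_)) → AffinelyIndependent v
independent-permute σ ind μ Σμ≡0 mass≡0 i =
  subst (λ j → μ j ≡ 0ℚ) (inverseʳ σ) (ind (μ ∘ (σ ⟨$⟩ʳ_)) Σ′ mass′ (σ ⟨$⟩ˡ i))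
  where
  permuted = relation-permute σ (Σμ≡0 , mass≡0)
  Σ′ = proj₁ permuted
  mass′ = proj₂ permuted

relation-drop : ∀ {n k} {v : Fin (suc k) → Vecℚ n} {μ} i → μ i ≡ 0ℚ →
                IsAffineRelation v μ → IsAffineRelation (v ∘ punchIn i) (μ ∘ punchIn i)
relation-drop {v = v} {μ} i μi≡0 (Σμ≡0 , mass≡0) =
  Σfin-drop μ i μi≡0 Σμ≡0 ,
  λ p → Σfin-drop (λ j → μ j * v j p) i (trans (cong (_* v i p) μi≡0) (*-zeroˡ (v i p))) (mass≡0 p)

independent-by-drop : ∀ {n k} {v : Fin (suc k) → Vecℚ n} i →
                      (∀ μ → IsAffineRelation v μ → μ i ≡ 0ℚ) →
                      AffinelyIndependent (v ∘ punchIn i) → AffinelyIndependent v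
independent-by-drop {v = v} i vanishes ind μ Σμ≡0 mass≡0 j with i ≟ j
... | yes refl = vanishes μ (Σμ≡0 , mass≡0)
... | no i≢j   = subst (λ l → μ l ≡ 0ℚ) (punchIn-punchOut i≢j) (ind (μ ∘ punchIn i) Σ′ mass′ (punchOut i≢j))
  where
  dropped = relation-drop {v = v} {μ} i (vanishes μ (Σμ≡0 , mass≡0)) (Σμ≡0 , mass≡0)
  Σ′ = proj₁ dropped
  mass′ = proj₂ dropped

bit : Bool → ℚ
bit true  = 1ℚ
bit false = 0ℚ

χ≡bit : ∀ {n} (W : Subset n) p → χ W p ≡ bit (lookup W p)
χ≡bit W p with lookup W p
... | true  = refl
... | false = refl

column : ∀ {n k} → (Fin k → Subset n) → Fin n → Vec Bool k
column Y p = tabulate (λ i → lookup (Y i) p)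

mass : ∀ {k} → (Fin k → ℚ) → Vec Bool k → ℚ
mass μ b = Σfin (λ i → μ i * bit (lookup b i))

relation-mass : ∀ {n k} {Y : Fin k → Subset n} {μ} → IsAffineRelation (χ ∘ Y) μ →
                ∀ p → mass μ (column Y p) ≡ 0ℚ
relation-mass {Y = Y} {μ} (_ , mass≡0) p = trans (Σfin-cong onColumn) (mass≡0 p)
  where
  onColumn : ∀ i → μ i * bit (lookup (column Y p) i) ≡ μ i * χ (Y i) p
  onColumn i = cong (μ i *_) (trans (cong bit (lookup∘tabulate _ i)) (sym (χ≡bit (Y i) p)))

OddOneOut : ∀ {k} → Vec Bool (suc k) → Fin (suc k) → Set
OddOneOut b i = ∀ j → lookup b (punchIn i j) ≡ not (lookup b i)

oddOneOut? : ∀ {k} (b : Vec Bool (suc k)) i → Dec (OddOneOut b i)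
oddOneOut? b i = all? (λ j → lookup b (punchIn i j) ≟ᵇ not (lookup b i))

-- The mass of b is μ i or Σ μ - μ i, according to the value of b i.
oddOneOut-vanishes : ∀ {k} {b : Vec Bool (suc k)} {μ i} → OddOneOut b i →
                     Σfin μ ≡ 0ℚ → mass μ b ≡ 0ℚ → μ i ≡ 0ℚ
oddOneOut-vanishes {k} {b} {μ} {i} odd Σμ≡0 mass≡0 = vanishes (lookup b i) split
  where
  split : μ i * bit (lookup b i) + Σfin (λ j → μ (punchIn i j) * bit (not (lookup b i))) ≡ 0ℚ
  split = begin
    μ i * bit (lookup b i) + Σfin (λ j → μ (punchIn i j) * bit (not (lookup b i)))
      ≡⟨ cong (μ i * bit (lookup b i) +_) (Σfin-cong (λ j → cong (λ x → μ (punchIn i j) * bit x) (odd j))) ⟨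
    μ i * bit (lookup b i) + Σfin (λ j → μ (punchIn i j) * bit (lookup b (punchIn i j)))
      ≡⟨ Σfin-punchIn (λ j → μ j * bit (lookup b j)) i ⟨
    mass μ b
      ≡⟨ mass≡0 ⟩
    0ℚ ∎
  rest : Σfin (μ ∘ punchIn i) ≡ 0ℚ → μ i ≡ 0ℚ
  rest Σrest≡0 = begin
    μ i                         ≡⟨ +-identityʳ (μ i) ⟨
    μ i + 0ℚ                    ≡⟨ cong (μ i +_) Σrest≡0 ⟨
    μ i + Σfin (μ ∘ punchIn i)  ≡⟨ Σfin-punchIn μ i ⟨
    Σfin μ                      ≡⟨ Σμ≡0 ⟩
    0ℚ                          ∎
  vanishes : ∀ x → μ i * bit x + Σfin (λ j → μ (punchIn i j) * bit (not x)) ≡ 0ℚ → μ i ≡ 0ℚ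
  vanishes true  e = begin
    μ i                                           ≡⟨ *-identityʳ (μ i) ⟨
    μ i * 1ℚ                                      ≡⟨ +-identityʳ _ ⟨
    μ i * 1ℚ + 0ℚ                                 ≡⟨ cong (μ i * 1ℚ +_) (Σfin-zero k) ⟨
    μ i * 1ℚ + Σfin {k} (λ _ → 0ℚ)                ≡⟨ cong (μ i * 1ℚ +_) (Σfin-cong (λ j → *-zeroʳ (μ (punchIn i j)))) ⟨
    μ i * 1ℚ + Σfin (λ j → μ (punchIn i j) * 0ℚ)  ≡⟨ e ⟩
    0ℚ                                            ∎
  vanishes false e = rest (begin
    Σfin (μ ∘ punchIn i)                          ≡⟨ Σfin-cong (λ j → *-identityʳ (μ (punchIn i j))) ⟨
    Σfin (λ j → μ (punchIn i j) * 1ℚ)             ≡⟨ +-identityˡ _ ⟨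
    0ℚ + Σfin (λ j → μ (punchIn i j) * 1ℚ)        ≡⟨ cong (_+ Σfin (λ j → μ (punchIn i j) * 1ℚ)) (*-zeroʳ (μ i)) ⟨
    μ i * 0ℚ + Σfin (λ j → μ (punchIn i j) * 1ℚ)  ≡⟨ e ⟩
    0ℚ                                            ∎)

oddOneOut-independent : ∀ {n k} (Y : Fin (suc k) → Subset n) {p i} → OddOneOut (column Y p) i →
                        AffinelyIndependent (χ ∘ Y ∘ punchIn i) → AffinelyIndependent (χ ∘ Y)
oddOneOut-independent Y {p} {i} odd = independent-by-drop {v = χ ∘ Y} i λ μ rel →
  oddOneOut-vanishes {b = column Y p} {μ} odd (proj₁ rel) (relation-mass {Y = Y} {μ} rel p)

separator : ∀ {n} {W Z : Subset n} → W ≢ Z → ∃ λ p → lookup W p ≢ lookup Z p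
separator {n} {W} {Z} W≢Z = ¬∀⟶∃¬ n _ (λ p → lookup W p ≟ᵇ lookup Z p) (W≢Z ∘ pointwise)
  where
  pointwise : (∀ p → lookup W p ≡ lookup Z p) → W ≡ Z
  pointwise W≗Z = begin
    W                   ≡⟨ tabulate∘lookup W ⟨
    tabulate (lookup W) ≡⟨ tabulate-cong W≗Z ⟩
    tabulate (lookup Z) ≡⟨ tabulate∘lookup Z ⟩
    Z                   ∎

∘punchIn-injective : ∀ {n k} {Y : Fin (suc k) → Subset n} i →
                     Injective _≡_ _≡_ Y → Injective _≡_ _≡_ (Y ∘ punchIn i)
∘punchIn-injective i inj {j} {l} = punchIn-injective i j l ∘ inj

nonconstant-oddOneOut : ∀ {k} → k ≤ 1 → (b : Vec Bool (suc (suc k))) →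
                        lookup b 0F ≢ lookup b 1F → ∃ (OddOneOut b)
nonconstant-oddOneOut z≤n b b₀≢b₁ = 0F , λ { 0F → ¬-not (b₀≢b₁ ∘ sym) }
nonconstant-oddOneOut (s≤s z≤n) b b₀≢b₁ with lookup b 2F ≟ᵇ lookup b 0F
... | yes b₂≡b₀ = 1F , λ { 0F → ¬-not b₀≢b₁ ; 1F → trans b₂≡b₀ (¬-not b₀≢b₁) }
... | no  b₂≢b₀ = 0F , λ { 0F → ¬-not (b₀≢b₁ ∘ sym) ; 1F → ¬-not b₂≢b₀ }

-- Restricted to k ≤ 3 because only then does every non-constant column have an odd one out.
distinct-independent : ∀ {n k} → k ≤ 3 → (Y : Fin k → Subset n) → Injective _≡_ _≡_ Y →
                       AffinelyIndependent (χ ∘ Y)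
distinct-independent {k = 0} _ _ _ _ _ _ ()
distinct-independent {k = 1} _ _ _ μ Σμ≡0 _ 0F = trans (sym (+-identityʳ (μ 0F))) Σμ≡0
distinct-independent {k = suc (suc k)} (s≤s (s≤s k≤1)) Y inj =
  oddOneOut-independent Y (proj₂ odd)
    (distinct-independent (s≤s (m≤n⇒m≤1+n k≤1)) (Y ∘ punchIn (proj₁ odd)) (∘punchIn-injective (proj₁ odd) inj))
  where
  Y₀≢Y₁ : Y 0F ≢ Y 1F
  Y₀≢Y₁ Y₀≡Y₁ with inj Y₀≡Y₁
  ... | ()
  splitting = separator Y₀≢Y₁
  odd = nonconstant-oddOneOut k≤1 (column Y (proj₁ splitting)) (proj₂ splitting)

dependent⇒no-oddOneOut : ∀ {n} {Y : Fin 4 → Subset n} → Injective _≡_ _≡_ Y → ¬ AffinelyIndependent (χ ∘ Y) →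
                 ∀ p → ¬ ∃ (OddOneOut (column Y p))
dependent⇒no-oddOneOut {Y = Y} inj dependent p (i , odd) =
  dependent (oddOneOut-independent Y odd (distinct-independent ≤-refl (Y ∘ punchIn i) (∘punchIn-injective i inj)))

Balanced : Vec Bool 4 → Set
Balanced (a ∷ b ∷ c ∷ d ∷ []) = a ∧ d ≡ b ∧ c × a ∨ d ≡ b ∨ c

balanced? : ∀ v → Dec (Balanced v)
balanced? (a ∷ b ∷ c ∷ d ∷ []) = (a ∧ d ≟ᵇ b ∧ c) ×-dec (a ∨ d ≟ᵇ b ∨ c)

-- χ (Y 0) + χ (Y 3) = χ (Y 1) + χ (Y 2), i.e. Y 0 ∩ Y 3 = Y 1 ∩ Y 2 and Y 0 ∪ Y 3 = Y 1 ∪ Y 2.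
Parallelogram : ∀ {n} → (Fin 4 → Subset n) → Set
Parallelogram Y = ∀ p → Balanced (column Y p)

parallelogram? : ∀ {n} (Y : Fin 4 → Subset n) → Dec (Parallelogram Y)
parallelogram? Y = all? (balanced? ∘ column Y)

oddOneOut-search : ∀ {k} (b : Vec Bool (suc k)) → {True (any? (oddOneOut? b))} → ∃ (OddOneOut b)
oddOneOut-search b {found} = toWitness found

Crossing : Vec Bool 4 → Set
Crossing v = v ≡ true ∷ false ∷ false ∷ true ∷ [] ⊎ v ≡ false ∷ true ∷ true ∷ false ∷ []

even-unbalanced-crossing : ∀ v → ¬ ∃ (OddOneOut v) → ¬ Balanced v → Crossing v
even-unbalanced-crossing (true  ∷ false ∷ false ∷ true  ∷ []) _ _ = inj₁ refl
even-unbalanced-crossing (false ∷ true  ∷ true  ∷ false ∷ []) _ _ = inj₂ refl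
even-unbalanced-crossing (false ∷ false ∷ false ∷ false ∷ []) _ unbalanced = ⊥-elim (unbalanced (refl , refl))
even-unbalanced-crossing (true  ∷ true  ∷ true  ∷ true  ∷ []) _ unbalanced = ⊥-elim (unbalanced (refl , refl))
even-unbalanced-crossing (true  ∷ true  ∷ false ∷ false ∷ []) _ unbalanced = ⊥-elim (unbalanced (refl , refl))
even-unbalanced-crossing (true  ∷ false ∷ true  ∷ false ∷ []) _ unbalanced = ⊥-elim (unbalanced (refl , refl))
even-unbalanced-crossing (false ∷ true  ∷ false ∷ true  ∷ []) _ unbalanced = ⊥-elim (unbalanced (refl , refl))
even-unbalanced-crossing (false ∷ false ∷ true  ∷ true  ∷ []) _ unbalanced = ⊥-elim (unbalanced (refl , refl))
even-unbalanced-crossing v@(true  ∷ false ∷ false ∷ false ∷ []) even _ = ⊥-elim (even (oddOneOut-search v))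
even-unbalanced-crossing v@(false ∷ true  ∷ false ∷ false ∷ []) even _ = ⊥-elim (even (oddOneOut-search v))
even-unbalanced-crossing v@(false ∷ false ∷ true  ∷ false ∷ []) even _ = ⊥-elim (even (oddOneOut-search v))
even-unbalanced-crossing v@(false ∷ false ∷ false ∷ true  ∷ []) even _ = ⊥-elim (even (oddOneOut-search v))
even-unbalanced-crossing v@(false ∷ true  ∷ true  ∷ true  ∷ []) even _ = ⊥-elim (even (oddOneOut-search v))
even-unbalanced-crossing v@(true  ∷ false ∷ true  ∷ true  ∷ []) even _ = ⊥-elim (even (oddOneOut-search v))
even-unbalanced-crossing v@(true  ∷ true  ∷ false ∷ true  ∷ []) even _ = ⊥-elim (even (oddOneOut-search v))
even-unbalanced-crossing v@(true  ∷ true  ∷ true  ∷ false ∷ []) even _ = ⊥-elim (even (oddOneOut-search v))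

crossing⇒diagonal-vanishes : ∀ μ {v} → Crossing v → Σfin μ ≡ 0ℚ → mass μ v ≡ 0ℚ → μ 0F + μ 3F ≡ 0ℚ
crossing⇒diagonal-vanishes μ (inj₁ refl) _ mass≡0 = trans
  (solve 4 (λ a b c d → a :+ d := a :* con 1ℚ :+ (b :* con 0ℚ :+ (c :* con 0ℚ :+ (d :* con 1ℚ :+ con 0ℚ))))
    refl (μ 0F) (μ 1F) (μ 2F) (μ 3F))
  mass≡0
crossing⇒diagonal-vanishes μ (inj₂ refl) Σμ≡0 mass≡0 = trans
  (solve 4 (λ a b c d → a :+ d := (a :+ (b :+ (c :+ (d :+ con 0ℚ))))
                                  :- (a :* con 0ℚ :+ (b :* con 1ℚ :+ (c :* con 1ℚ :+ (d :* con 0ℚ :+ con 0ℚ)))))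
    refl (μ 0F) (μ 1F) (μ 2F) (μ 3F))
  (cong₂ _-_ Σμ≡0 mass≡0)

opposite-sums-vanish : ∀ (μ : Fin 4 → ℚ) → Σfin μ ≡ 0ℚ →
                       μ 0F + μ 3F ≡ 0ℚ → μ 0F + μ 2F ≡ 0ℚ → μ 0F + μ 1F ≡ 0ℚ → ∀ i → μ i ≡ 0ℚ
opposite-sums-vanish μ Σμ≡0 e₀₃ e₀₂ e₀₁ = vanishes
  where
  μ₀≡0 : μ 0F ≡ 0ℚ
  μ₀≡0 = trans
    (solve 4 (λ a b c d → a := con ½ :* (((a :+ b) :+ ((a :+ c) :+ (a :+ d))) :- (a :+ (b :+ (c :+ (d :+ con 0ℚ))))))
      refl (μ 0F) (μ 1F) (μ 2F) (μ 3F))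
    (cong (½ *_) (cong₂ _-_ (cong₂ _+_ e₀₁ (cong₂ _+_ e₀₂ e₀₃)) Σμ≡0))
  partner : ∀ i → μ 0F + μ i ≡ 0ℚ → μ i ≡ 0ℚ
  partner i e = trans (solve 2 (λ a b → b := (a :+ b) :- a) refl (μ 0F) (μ i)) (cong₂ _-_ e μ₀≡0)
  vanishes : ∀ i → μ i ≡ 0ℚ
  vanishes 0F = μ₀≡0
  vanishes 1F = partner 1F e₀₁
  vanishes 2F = partner 2F e₀₂
  vanishes 3F = partner 3F e₀₃

permute-injective : ∀ {n k} {Y : Fin k → Subset n} (σ : Permutation′ k) →
                    Injective _≡_ _≡_ Y → Injective _≡_ _≡_ (Y ∘ (σ ⟨$⟩ʳ_))
permute-injective σ inj {i} {j} Yσi≡Yσj = begin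
  i                          ≡⟨ inverseˡ σ ⟨
  σ ⟨$⟩ˡ (σ ⟨$⟩ʳ i)          ≡⟨ cong (σ ⟨$⟩ˡ_) (inj Yσi≡Yσj) ⟩
  σ ⟨$⟩ˡ (σ ⟨$⟩ʳ j)          ≡⟨ inverseˡ σ ⟩
  j                          ∎

-- The identity, (2 3) and (1 3) move each of the three pairings onto the diagonals {0, 3} and {1, 2}.
dependent⇒parallelogram : ∀ {n} (X : Fin 4 → Subset n) → Injective _≡_ _≡_ X → ¬ AffinelyIndependent (χ ∘ X) →
                          Σ (Permutation′ 4) λ σ → Parallelogram (X ∘ (σ ⟨$⟩ʳ_))
dependent⇒parallelogram X inj dependent
  with parallelogram? X | parallelogram? (X ∘ (transpose 2F 3F ⟨$⟩ʳ_)) | parallelogram? (X ∘ (transpose 1F 3F ⟨$⟩ʳ_))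
... | yes par | _       | _       = id , par
... | no _    | yes par | _       = transpose 2F 3F , par
... | no _    | no _    | yes par = transpose 1F 3F , par
... | no ¬par | no ¬par₂₃ | no ¬par₁₃ = ⊥-elim (dependent λ μ Σμ≡0 mass≡0 →
  opposite-sums-vanish μ Σμ≡0 (diagonal id ¬par μ (Σμ≡0 , mass≡0))
    (diagonal (transpose 2F 3F) ¬par₂₃ μ (Σμ≡0 , mass≡0)) (diagonal (transpose 1F 3F) ¬par₁₃ μ (Σμ≡0 , mass≡0)))
  where
  diagonal : ∀ σ → ¬ Parallelogram (X ∘ (σ ⟨$⟩ʳ_)) → ∀ μ → IsAffineRelation (χ ∘ X) μ →
             μ (σ ⟨$⟩ʳ 0F) + μ (σ ⟨$⟩ʳ 3F) ≡ 0ℚ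
  diagonal σ ¬parallelogram μ rel =
    crossing⇒diagonal-vanishes (μ ∘ (σ ⟨$⟩ʳ_)) crossing (proj₁ rel′) (relation-mass {Y = Y} {μ ∘ (σ ⟨$⟩ʳ_)} rel′ p)
    where
    Y = X ∘ (σ ⟨$⟩ʳ_)
    rel′ = relation-permute {v = χ ∘ X} {μ} σ rel
    unbalanced = ¬∀⟶∃¬ _ _ (balanced? ∘ column Y) ¬parallelogram
    p = proj₁ unbalanced
    even = dependent⇒no-oddOneOut {Y = Y} (permute-injective σ inj) (dependent ∘ independent-permute {v = χ ∘ X} σ) p
    crossing = even-unbalanced-crossing (column Y p) even (proj₂ unbalanced)

-- Columns of the points lying in exactly two sets adjacent on the square Y 0 – Y 1 – Y 3 – Y 2.
side : Fin 4 → Vec Bool 4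
side 0F = true  ∷ true  ∷ false ∷ false ∷ []
side 1F = true  ∷ false ∷ true  ∷ false ∷ []
side 2F = false ∷ true  ∷ false ∷ true  ∷ []
side 3F = false ∷ false ∷ true  ∷ true  ∷ []

balanced-shape : ∀ v → Balanced v → v ≡ replicate 4 false ⊎ v ≡ replicate 4 true ⊎ ∃ λ s → v ≡ side s
balanced-shape (false ∷ false ∷ false ∷ false ∷ []) _ = inj₁ refl
balanced-shape (true  ∷ true  ∷ true  ∷ true  ∷ []) _ = inj₂ (inj₁ refl)
balanced-shape (true  ∷ true  ∷ false ∷ false ∷ []) _ = inj₂ (inj₂ (0F , refl))
balanced-shape (true  ∷ false ∷ true  ∷ false ∷ []) _ = inj₂ (inj₂ (1F , refl))
balanced-shape (false ∷ true  ∷ false ∷ true  ∷ []) _ = inj₂ (inj₂ (2F , refl))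
balanced-shape (false ∷ false ∷ true  ∷ true  ∷ []) _ = inj₂ (inj₂ (3F , refl))
balanced-shape (true  ∷ false ∷ false ∷ false ∷ []) (_ , ())
balanced-shape (false ∷ true  ∷ false ∷ false ∷ []) (_ , ())
balanced-shape (false ∷ false ∷ true  ∷ false ∷ []) (_ , ())
balanced-shape (false ∷ false ∷ false ∷ true  ∷ []) (_ , ())
balanced-shape (false ∷ true  ∷ true  ∷ true  ∷ []) (() , _)
balanced-shape (true  ∷ false ∷ true  ∷ true  ∷ []) (() , _)
balanced-shape (true  ∷ true  ∷ false ∷ true  ∷ []) (() , _)
balanced-shape (true  ∷ true  ∷ true  ∷ false ∷ []) (() , _)
balanced-shape (true  ∷ false ∷ false ∷ true  ∷ []) (() , _)
balanced-shape (false ∷ true  ∷ true  ∷ false ∷ []) (_ , ())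

SideOrder : Vec Bool 4 → Fin 4 → Fin 4 → Set
SideOrder o i j = ∀ s → lookup (side s) i ≡ true → lookup (side s) j ≡ false → lookup o s ≡ false

sideOrder? : ∀ o i j → Dec (SideOrder o i j)
sideOrder? o i j = all? λ s → (lookup (side s) i ≟ᵇ true) →-dec (lookup (side s) j ≟ᵇ false) →-dec (lookup o s ≟ᵇ false)

occupied? : ∀ {n} (Y : Fin 4 → Subset n) s → Dec (∃ λ p → column Y p ≡ side s)
occupied? Y s = any? λ p → ≡-decⱽ _≟ᵇ_ (column Y p) (side s)

occupancy : ∀ {n} → (Fin 4 → Subset n) → Vec Bool 4
occupancy Y = tabulate (does ∘ occupied? Y)

true≢false : true ≢ false
true≢false ()

module _ {n} (Y : Fin 4 → Subset n) where

  column-lookup : ∀ {p v} i → column Y p ≡ v → lookup (Y i) p ≡ lookup v i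
  column-lookup {p} i refl = sym (lookup∘tabulate (λ j → lookup (Y j) p) i)

  occupied : ∀ {p s} → column Y p ≡ side s → lookup (occupancy Y) s ≡ true
  occupied {p} {s} column≡side =
    trans (lookup∘tabulate (does ∘ occupied? Y) s) (dec-true (occupied? Y s) (p , column≡side))

  unoccupied : ∀ {s} → (∀ p → column Y p ≢ side s) → lookup (occupancy Y) s ≡ false
  unoccupied {s} never =
    trans (lookup∘tabulate (does ∘ occupied? Y) s) (dec-false (occupied? Y s) λ (p , column≡side) → never p column≡side)

  ⊆⇔sideOrder : Parallelogram Y → ∀ i j → Y i ⊆ Y j ⇔ SideOrder (occupancy Y) i j
  ⊆⇔sideOrder parallelogram i j = mk⇔ to from
    where
    to : Y i ⊆ Y j → SideOrder (occupancy Y) i j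
    to Yi⊆Yj s i∈s j∉s = unoccupied {s} λ p column≡side →
      true≢false (trans (sym ([]=⇒lookup (Yi⊆Yj (lookup⇒[]= p (Y i) (trans (column-lookup i column≡side) i∈s)))))
                        (trans (column-lookup j column≡side) j∉s))
    reaches : SideOrder (occupancy Y) i j → ∀ p → lookup (Y i) p ≡ true → lookup (Y j) p ≡ true
    reaches order p p∈Yi with balanced-shape (column Y p) (parallelogram p)
    ... | inj₁ empty = ⊥-elim (true≢false (trans (sym p∈Yi) (trans (column-lookup i empty) (lookup-replicate i false))))
    ... | inj₂ (inj₁ full) = trans (column-lookup j full) (lookup-replicate j true)
    ... | inj₂ (inj₂ (s , column≡side)) with lookup (side s) j in j∈s
    ...   | true  = trans (column-lookup j column≡side) j∈s
    ...   | false = ⊥-elim (true≢false (trans (sym (occupied column≡side))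
                      (order s (trans (sym (column-lookup i column≡side)) p∈Yi) j∈s)))
    from : SideOrder (occupancy Y) i j → Y i ⊆ Y j
    from order {p} p∈Yi = lookup⇒[]= p (Y j) (reaches order p ([]=⇒lookup p∈Yi))

OfSquareType : (Fin 4 → Fin 4 → Set) → Set
OfSquareType R = Iso4 R BooleanRank2 ⊎ Iso4 R TwoChains ⊎ Iso4 R Antichain4

booleanRank2? : ∀ i j → Dec (BooleanRank2 i j)
booleanRank2? i j = i ≟ j ⊎-dec i ≟ 0F ⊎-dec j ≟ 3F

twoChains? : ∀ i j → Dec (TwoChains i j)
twoChains? i j = i ≟ j ⊎-dec (i ≟ 0F ×-dec j ≟ 1F) ⊎-dec (i ≟ 2F ×-dec j ≟ 3F)

module _ {R S : Fin 4 → Fin 4 → Set} (R? : ∀ i j → Dec (R i j)) (S? : ∀ i j → Dec (S i j)) where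

  isoVia? : ∀ π → Dec (∀ i j → (R i j → S (π ⟨$⟩ʳ i) (π ⟨$⟩ʳ j)) × (S (π ⟨$⟩ʳ i) (π ⟨$⟩ʳ j) → R i j))
  isoVia? π = all? λ i → all? λ j → (R? i j →-dec S? _ _) ×-dec (S? _ _ →-dec R? i j)

  isoVia : ∀ π → {True (isoVia? π)} → Iso4 R S
  isoVia π {checked} = π , toWitness checked

module _ (o : Vec Bool 4) where

  decided : ∀ i j → {True (sideOrder? o i j)} → SideOrder o i j
  decided i j {checked} = toWitness checked

  booleanRank2-via : ∀ π → {True (isoVia? (sideOrder? o) booleanRank2? π)} → OfSquareType (SideOrder o)
  booleanRank2-via π {checked} = inj₁ (isoVia (sideOrder? o) booleanRank2? π {checked})

  twoChains-via : ∀ π → {True (isoVia? (sideOrder? o) twoChains? π)} → OfSquareType (SideOrder o)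
  twoChains-via π {checked} = inj₂ (inj₁ (isoVia (sideOrder? o) twoChains? π {checked}))

  antichain4-via : ∀ π → {True (isoVia? (sideOrder? o) (λ i j → i ≟ j) π)} → OfSquareType (SideOrder o)
  antichain4-via π {checked} = inj₂ (inj₂ (isoVia (sideOrder? o) (λ i j → i ≟ j) π {checked}))

side-order-type : ∀ o → (∀ i j → SideOrder o i j → SideOrder o j i → i ≡ j) → OfSquareType (SideOrder o)
side-order-type o@(_ ∷ false ∷ false ∷ _ ∷ []) antisym with antisym 0F 1F (decided o 0F 1F) (decided o 1F 0F)
... | ()
side-order-type o@(false ∷ _ ∷ _ ∷ false ∷ []) antisym with antisym 0F 2F (decided o 0F 2F) (decided o 2F 0F)
... | ()
side-order-type o@(true  ∷ true  ∷ true  ∷ true  ∷ []) _ = antichain4-via o id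
side-order-type o@(false ∷ true  ∷ true  ∷ true  ∷ []) _ = twoChains-via o (transpose 1F 2F)
side-order-type o@(true  ∷ false ∷ true  ∷ true  ∷ []) _ = twoChains-via o id
side-order-type o@(true  ∷ true  ∷ false ∷ true  ∷ []) _ = twoChains-via o (transpose 0F 1F ∘ₚ transpose 2F 3F)
side-order-type o@(true  ∷ true  ∷ true  ∷ false ∷ []) _ = twoChains-via o (transpose 0F 3F)
side-order-type o@(false ∷ false ∷ true  ∷ true  ∷ []) _ = booleanRank2-via o id
side-order-type o@(true  ∷ true  ∷ false ∷ false ∷ []) _ = booleanRank2-via o (transpose 0F 3F)
side-order-type o@(true  ∷ false ∷ true  ∷ false ∷ []) _ = booleanRank2-via o (transpose 0F 2F ∘ₚ transpose 1F 3F)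
side-order-type o@(false ∷ true  ∷ false ∷ true  ∷ []) _ = booleanRank2-via o (transpose 0F 1F ∘ₚ transpose 2F 3F)

module _ {R R′ : Fin 4 → Fin 4 → Set} where

  Iso4-resp : ∀ {S} → (∀ i j → R′ i j ⇔ R i j) → Iso4 R S → Iso4 R′ S
  Iso4-resp R′⇔R (π , iso) = π , λ i j →
    proj₁ (iso i j) ∘ Equivalence.to (R′⇔R i j) , Equivalence.from (R′⇔R i j) ∘ proj₂ (iso i j)

  OfSquareType-resp : (∀ i j → R′ i j ⇔ R i j) → OfSquareType R → OfSquareType R′
  OfSquareType-resp R′⇔R =
    map⊎ (Iso4-resp {BooleanRank2} R′⇔R) (map⊎ (Iso4-resp {TwoChains} R′⇔R) (Iso4-resp {Antichain4} R′⇔R))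

module _ {R : Fin 4 → Fin 4 → Set} (σ : Permutation′ 4) where

  Iso4-reindex : ∀ {S} → Iso4 (λ i j → R (σ ⟨$⟩ʳ i) (σ ⟨$⟩ʳ j)) S → Iso4 R S
  Iso4-reindex (π , iso) = flip σ ∘ₚ π , λ i j →
    proj₁ (iso (σ ⟨$⟩ˡ i) (σ ⟨$⟩ˡ j)) ∘ subst₂ R (sym (inverseʳ σ)) (sym (inverseʳ σ)) ,
    subst₂ R (inverseʳ σ) (inverseʳ σ) ∘ proj₂ (iso (σ ⟨$⟩ˡ i) (σ ⟨$⟩ˡ j))

  OfSquareType-reindex : OfSquareType (λ i j → R (σ ⟨$⟩ʳ i) (σ ⟨$⟩ʳ j)) → OfSquareType R
  OfSquareType-reindex =
    map⊎ (Iso4-reindex {BooleanRank2}) (map⊎ (Iso4-reindex {TwoChains}) (Iso4-reindex {Antichain4}))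

parallelogram-type : ∀ {n} (Y : Fin 4 → Subset n) → Parallelogram Y → Injective _≡_ _≡_ Y →
                     OfSquareType (λ i j → Y i ⊆ Y j)
parallelogram-type Y parallelogram inj =
  OfSquareType-resp (⊆⇔sideOrder Y parallelogram) (side-order-type (occupancy Y) antisym)
  where
  antisym : ∀ i j → SideOrder (occupancy Y) i j → SideOrder (occupancy Y) j i → i ≡ j
  antisym i j i≤j j≤i = inj (⊆-antisym (Equivalence.from (⊆⇔sideOrder Y parallelogram i j) i≤j)
                                       (Equivalence.from (⊆⇔sideOrder Y parallelogram j i) j≤i))

module _ {ℓ} {X : Set ℓ} {a b c d : X} where

  quad-injective : a ≢ b → a ≢ c → a ≢ d → b ≢ c → b ≢ d → c ≢ d → Injective _≡_ _≡_ (quad a b c d)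
  quad-injective _   _   _   _   _   _   {0F} {0F} _ = refl
  quad-injective a≢b _   _   _   _   _   {0F} {1F} e = ⊥-elim (a≢b e)
  quad-injective _   a≢c _   _   _   _   {0F} {2F} e = ⊥-elim (a≢c e)
  quad-injective _   _   a≢d _   _   _   {0F} {3F} e = ⊥-elim (a≢d e)
  quad-injective a≢b _   _   _   _   _   {1F} {0F} e = ⊥-elim (a≢b (sym e))
  quad-injective _   _   _   _   _   _   {1F} {1F} _ = refl
  quad-injective _   _   _   b≢c _   _   {1F} {2F} e = ⊥-elim (b≢c e)
  quad-injective _   _   _   _   b≢d _   {1F} {3F} e = ⊥-elim (b≢d e)
  quad-injective _   a≢c _   _   _   _   {2F} {0F} e = ⊥-elim (a≢c (sym e))
  quad-injective _   _   _   b≢c _   _   {2F} {1F} e = ⊥-elim (b≢c (sym e))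
  quad-injective _   _   _   _   _   _   {2F} {2F} _ = refl
  quad-injective _   _   _   _   _   c≢d {2F} {3F} e = ⊥-elim (c≢d e)
  quad-injective _   _   a≢d _   _   _   {3F} {0F} e = ⊥-elim (a≢d (sym e))
  quad-injective _   _   _   _   b≢d _   {3F} {1F} e = ⊥-elim (b≢d (sym e))
  quad-injective _   _   _   _   _   c≢d {3F} {2F} e = ⊥-elim (c≢d (sym e))
  quad-injective _   _   _   _   _   _   {3F} {3F} _ = refl

quad-χ : ∀ {n} (A B C D : Subset n) i p → χ (quad A B C D i) p ≡ quad (χ A) (χ B) (χ C) (χ D) i p
quad-χ A B C D 0F p = refl
quad-χ A B C D 1F p = refl
quad-χ A B C D 2F p = refl
quad-χ A B C D 3F p = refl

proposition5p8 : (n : ℕ) (P : FinPoset n) (A B C D : Subset n) →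
    IsAntichain P A → IsAntichain P B → IsAntichain P C → IsAntichain P D →
    A ≢ B → A ≢ C → A ≢ D → B ≢ C → B ≢ D → C ≢ D →
    IsSquareFaceOf (Conv (quad (χ A) (χ B) (χ C) (χ D))) (ChainPolytope P) →
    let R = λ i j → quad A B C D i ⊆ quad A B C D j in
    Iso4 R BooleanRank2 ⊎ Iso4 R TwoChains ⊎ Iso4 R Antichain4
proposition5p8 n _ A B C D _ _ _ _ A≢B A≢C A≢D B≢C B≢D C≢D (_ , (_ , no-four-independent) , _) =
  OfSquareType-reindex σ (parallelogram-type (X ∘ (σ ⟨$⟩ʳ_)) parallelogram (permute-injective σ X-injective))
  where
  X : Fin 4 → Subset n
  X = quad A B C D
  X-injective : Injective _≡_ _≡_ X
  X-injective = quad-injective A≢B A≢C A≢D B≢C B≢D C≢D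
  dependent : ¬ AffinelyIndependent (χ ∘ X)
  dependent = no-four-independent vertices (Conv-vertex vertices) ∘ independent-resp (quad-χ A B C D)
    where
    vertices = quad (χ A) (χ B) (χ C) (χ D)
  relabelled = dependent⇒parallelogram X X-injective dependent
  σ = proj₁ relabelled
  parallelogram = proj₂ relabelled
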